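{- Let $X=\{X_1,X_2\}$ be a $\lambda_2$-equitable $2$-partition of $J(n,3)$ with quotient matrix $(p_{ij})$ satisfying $p_{11}\geq p_{22}$ and $p_{11}\geq 2n-7$. Let $\{a,b,c\}$ be a vertex with $\overline{abc}=1$, labelled so that $\overline{ab\ast}\geq\overline{ac\ast}\geq\overline{bc\ast}$, and suppose $\overline{ab\ast}-\overline{ac\ast}=\overline{ac\ast}-\overline{bc\ast}=(n-4)/2$. Then $n\leq 8$.
   Context: $J(n,3)$ ($n\geq 6$): vertices are the $3$-subsets of $[n]$, adjacent iff they share exactly two elements; it is $3(n-3)$-regular. An equitable $2$-partition with quotient matrix $(p_{ij})$ means each vertex of $X_i$ has exactly $p_{ij}$ neighbours in $X_j$; $\lambda_2$-equitable means $p_{11}-p_{21}=n-7$. $\overline{u}=1$ if $u\in X_1$, else $0$; $\overline{xyz}=\overline{\{x,y,z\}}$; $\overline{ij\ast}$ is the number of $3$-subsets containing $i,j$ lying in $X_1$. -}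

module Defs where

open import Data.Nat using (ℕ; zero; suc; _≟_)
open import Data.Bool using (Bool; true; false; _∧_; not; if_then_else_)
open import Data.Fin using (Fin)
open import Data.Fin.Subset using (Subset; _∩_; ∣_∣; ⁅_⁆; _∪_)
open import Data.Vec using (_∷_; []; lookup)
open import Data.List using (List; []; _∷_; map; _++_; filterᵇ; length)
open import Relation.Nullary.Decidable using (⌊_⌋)

allSubsets : (n : ℕ) → List (Subset n)
allSubsets zero = [] ∷ []
allSubsets (suc n) = map (true ∷_) (allSubsets n) ++ map (false ∷_) (allSubsets n)

vertices : (n : ℕ) → List (Subset n)
vertices n = filterᵇ (λ s → ⌊ ∣ s ∣ ≟ 3 ⌋) (allSubsets n)

adjᵇ : {n : ℕ} → Subset n → Subset n → Bool
adjᵇ s t = ⌊ ∣ s ∩ t ∣ ≟ 2 ⌋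

-- A 2-partition {X₁, X₂} of V(J(n,3)) is given by its indicator
-- (ū = X u, true iff u ∈ X₁).  Cell membership: cell X true = X₁, cell X false = X₂.
inCell : {n : ℕ} → (Subset n → Bool) → Bool → Subset n → Bool
inCell X true  u = X u
inCell X false u = not (X u)

nbrsIn : {n : ℕ} → (Subset n → Bool) → Bool → Subset n → ℕ
nbrsIn {n} X j u = length (filterᵇ (λ t → adjᵇ u t ∧ inCell X j t) (vertices n))

-- quotient matrix entry p i j, with index true ↦ 1, false ↦ 2
record Quot : Set where
  field
    p11 p12 p21 p22 : ℕ

entry : Quot → Bool → Bool → ℕ
entry q true  true  = Quot.p11 q
entry q true  false = Quot.p12 q
entry q false true  = Quot.p21 q
entry q false false = Quot.p22 q

open import Data.Product using (Σ; _×_)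
open import Relation.Binary.PropositionalEquality using (_≡_)

record IsEquitable (n : ℕ) (X : Subset n → Bool) (q : Quot) : Set where
  field
    cell1-nonempty : Σ (Subset n) (λ u → ∣ u ∣ ≡ 3 × X u ≡ true)
    cell2-nonempty : Σ (Subset n) (λ u → ∣ u ∣ ≡ 3 × X u ≡ false)
    regular : ∀ u → ∣ u ∣ ≡ 3 → ∀ j → nbrsIn X j u ≡ entry q (X u) j

-- λ₂-equitable: p11 - p21 = n - 7 (as integers), written without subtraction.
Isλ₂ : ℕ → Quot → Set
Isλ₂ n q = Quot.p11 q Data.Nat.+ 7 ≡ Quot.p21 q Data.Nat.+ n

-- \overline{ij*}: number of 3-subsets containing i and j lying in X₁
pairCount : {n : ℕ} → (Subset n → Bool) → Fin n → Fin n → ℕ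
pairCount {n} X i j = length (filterᵇ (λ t → lookup t i ∧ lookup t j ∧ X t) (vertices n))

triple : {n : ℕ} → Fin n → Fin n → Fin n → Subset n
triple a b c = ⁅ a ⁆ ∪ (⁅ b ⁆ ∪ ⁅ c ⁆)

module Submission where

-- Write AB, AC, BC for the three pair counts of abc, so that AB = BC + 2d, AC = BC + d and n = 2d + 4.
-- A neighbour of abc contains exactly two of a, b, c while abc itself contains all three, so counting
-- the members of X₁ through the pairs they contain gives p₁₁ + 3 ≤ AB + AC + BC = 3 BC + 3d. Only n − 2
-- vertices contain both a and b, so AB ≤ 2d + 2 and BC ≤ 2. Now 4d + 1 = 2n − 7 ≤ p₁₁ ≤ 3 BC + 3d − 3
-- forces d ≤ 2, i.e. n ≤ 8.

open import Defs
open import Data.Bool using (Bool; true; false; _∧_; _∨_)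
open import Data.Bool.Properties using (¬-not; ∧-zeroʳ)
open import Data.Fin using (Fin; zero; suc)
open import Data.Fin.Subset using (Subset; _∩_; _∪_; _⊆_; ⁅_⁆; ∣_∣; ⊤; ⊥)
open import Data.Fin.Subset.Properties
  using ( ∩-zeroˡ; ∩-identityʳ; ∩-idem; ∪-identityˡ; x∈⁅x⁆; x∈⁅y⁆⇒x≡y; x≢y⇒x∉⁅y⁆; x∈p∪q⁺; x∈p∪q⁻
        ; ∣⊥∣≡0; ∣⁅x⁆∣≡1; ∣p∣≤n; p⊆q⇒∣p∣≤∣q∣; _⊆?_)
open import Data.List using (List; []; _∷_; map; _++_; filterᵇ; length)
open import Data.List.Membership.Propositional using (_∈_)
open import Data.List.Membership.Propositional.Properties using (∈-map⁺; ∈-++⁺ˡ; ∈-++⁺ʳ; ∈-filter⁺)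
open import Data.List.Properties using (map-cong; map-∘; filter-++; length-++)
open import Data.List.Relation.Unary.Any using (here; there)
open import Data.Nat using (ℕ; zero; suc; _+_; _*_; _∸_; _≤_; z≤n; s≤s; _≟_)
open import Data.Nat.Combinatorics using (_C_; nCk+nC[k+1]≡[n+1]C[k+1]; nC1≡n)
open import Data.Nat.ListAction using (sum)
open import Data.Nat.Properties
open import Algebra.Properties.CommutativeSemigroup +-commutativeSemigroup using (interchange; xy∙z≈xz∙y; x∙yz≈y∙xz)
open import Data.Nat.Tactic.RingSolver using (solve-∀)
open import Data.Sum using (inj₁; inj₂)
open import Data.Vec using (_∷_; []; lookup)
open import Data.Vec.Properties using (lookup-zipWith; lookup-replicate; lookup⇒[]=; []=⇒lookup)
open import Function using (_∘_)
open import Relation.Binary.PropositionalEquality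
  using (_≡_; _≢_; refl; sym; trans; cong; cong₂; subst; subst₂; module ≡-Reasoning)
open import Relation.Nullary.Decidable using (yes; no; T?; does; ⌊_⌋; fromWitness; dec-true; dec-false)

⟦_⟧ : Bool → ℕ
⟦ true ⟧  = 1
⟦ false ⟧ = 0

module _ {A : Set} where

  count : (A → Bool) → List A → ℕ
  count P xs = length (filterᵇ P xs)

  count-∷ : ∀ (P : A → Bool) x xs → count P (x ∷ xs) ≡ ⟦ P x ⟧ + count P xs
  count-∷ P x xs with P x
  ... | true  = refl
  ... | false = refl

  count≡sum : ∀ (P : A → Bool) xs → count P xs ≡ sum (map (λ x → ⟦ P x ⟧) xs)
  count≡sum P []       = refl
  count≡sum P (x ∷ xs) = trans (count-∷ P x xs) (cong (⟦ P x ⟧ +_) (count≡sum P xs))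

  sum-map-+ : ∀ (f g : A → ℕ) xs → sum (map (λ x → f x + g x) xs) ≡ sum (map f xs) + sum (map g xs)
  sum-map-+ f g []       = refl
  sum-map-+ f g (x ∷ xs) =
    trans (cong (f x + g x +_) (sum-map-+ f g xs)) (interchange (f x) (g x) (sum (map f xs)) (sum (map g xs)))

  sum-map-mono : ∀ {f g : A → ℕ} → (∀ x → f x ≤ g x) → ∀ xs → sum (map f xs) ≤ sum (map g xs)
  sum-map-mono f≤g []       = z≤n
  sum-map-mono f≤g (x ∷ xs) = +-mono-≤ (f≤g x) (sum-map-mono f≤g xs)

  sum-map-mono-∈ : ∀ {f g : A → ℕ} {x₀ xs} k → (∀ x → f x ≤ g x) → x₀ ∈ xs → f x₀ + k ≤ g x₀ →
                   sum (map f xs) + k ≤ sum (map g xs)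
  sum-map-mono-∈ {f} {g} {xs = x ∷ xs} k f≤g (here refl) fx+k≤gx = begin
    f x + sum (map f xs) + k ≡⟨ xy∙z≈xz∙y (f x) _ k ⟩
    f x + k + sum (map f xs) ≤⟨ +-mono-≤ fx+k≤gx (sum-map-mono f≤g xs) ⟩
    g x + sum (map g xs)     ∎
    where open ≤-Reasoning
  sum-map-mono-∈ {f} {g} {xs = x ∷ xs} k f≤g (there x₀∈xs) fx₀+k≤gx₀ = begin
    f x + sum (map f xs) + k   ≡⟨ +-assoc (f x) _ k ⟩
    f x + (sum (map f xs) + k) ≤⟨ +-mono-≤ (f≤g x) (sum-map-mono-∈ k f≤g x₀∈xs fx₀+k≤gx₀) ⟩
    g x + sum (map g xs)       ∎
    where open ≤-Reasoning

  count-cong : ∀ {P Q : A → Bool} → (∀ x → P x ≡ Q x) → ∀ xs → count P xs ≡ count Q xs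
  count-cong {P} {Q} P≗Q xs = begin
    count P xs                   ≡⟨ count≡sum P xs ⟩
    sum (map (λ x → ⟦ P x ⟧) xs) ≡⟨ cong sum (map-cong (λ x → cong ⟦_⟧ (P≗Q x)) xs) ⟩
    sum (map (λ x → ⟦ Q x ⟧) xs) ≡⟨ count≡sum Q xs ⟨
    count Q xs                   ∎
    where open ≡-Reasoning

  count-mono : ∀ {P Q : A → Bool} → (∀ x → P x ≡ true → Q x ≡ true) → ∀ xs → count P xs ≤ count Q xs
  count-mono {P} {Q} P⇒Q xs = begin
    count P xs                   ≡⟨ count≡sum P xs ⟩
    sum (map (λ x → ⟦ P x ⟧) xs) ≤⟨ sum-map-mono (λ x → ⟦⟧-mono (P⇒Q x)) xs ⟩
    sum (map (λ x → ⟦ Q x ⟧) xs) ≡⟨ count≡sum Q xs ⟨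
    count Q xs                   ∎
    where
    open ≤-Reasoning
    ⟦⟧-mono : ∀ {b c} → (b ≡ true → c ≡ true) → ⟦ b ⟧ ≤ ⟦ c ⟧
    ⟦⟧-mono {false} b⇒c = z≤n
    ⟦⟧-mono {true}  b⇒c rewrite b⇒c refl = ≤-refl

  count-none : ∀ {P : A → Bool} → (∀ x → P x ≡ false) → ∀ xs → count P xs ≡ 0
  count-none {P} ¬P []       = refl
  count-none {P} ¬P (x ∷ xs) = trans (count-∷ P x xs) (cong₂ _+_ (cong ⟦_⟧ (¬P x)) (count-none ¬P xs))

  count-++ : ∀ (P : A → Bool) xs ys → count P (xs ++ ys) ≡ count P xs + count P ys
  count-++ P xs ys = trans (cong length (filter-++ (T? ∘ P) xs ys)) (length-++ (filterᵇ P xs))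

  count-filterᵇ : ∀ (P Q : A → Bool) xs → count Q (filterᵇ P xs) ≡ count (λ x → P x ∧ Q x) xs
  count-filterᵇ P Q []       = refl
  count-filterᵇ P Q (x ∷ xs) rewrite count-∷ (λ y → P y ∧ Q y) x xs with P x
  ... | true  = trans (count-∷ Q x (filterᵇ P xs)) (cong (⟦ Q x ⟧ +_) (count-filterᵇ P Q xs))
  ... | false = count-filterᵇ P Q xs

count-map : ∀ {A B : Set} (P : B → Bool) (f : A → B) xs → count P (map f xs) ≡ count (P ∘ f) xs
count-map P f xs = begin
  count P (map f xs)                   ≡⟨ count≡sum P (map f xs) ⟩
  sum (map (λ y → ⟦ P y ⟧) (map f xs)) ≡⟨ cong sum (map-∘ xs) ⟨
  sum (map (λ x → ⟦ P (f x) ⟧) xs)     ≡⟨ count≡sum (P ∘ f) xs ⟨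
  count (P ∘ f) xs                     ∎
  where open ≡-Reasoning

∈-allSubsets : ∀ {n} (s : Subset n) → s ∈ allSubsets n
∈-allSubsets []                  = here refl
∈-allSubsets (true ∷ s)          = ∈-++⁺ˡ (∈-map⁺ (true ∷_) (∈-allSubsets s))
∈-allSubsets {suc n} (false ∷ s) = ∈-++⁺ʳ (map (true ∷_) (allSubsets n)) (∈-map⁺ (false ∷_) (∈-allSubsets s))

count-allSubsets : ∀ {n} (P : Subset (suc n) → Bool) →
  count P (allSubsets (suc n)) ≡ count (P ∘ (true ∷_)) (allSubsets n) + count (P ∘ (false ∷_)) (allSubsets n)
count-allSubsets {n} P =
  trans (count-++ P (map (true ∷_) (allSubsets n)) (map (false ∷_) (allSubsets n)))
        (cong₂ _+_ (count-map P (true ∷_) (allSubsets n)) (count-map P (false ∷_) (allSubsets n)))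

∣x∷p∣ : ∀ {n} x (p : Subset n) → ∣ x ∷ p ∣ ≡ ⟦ x ⟧ + ∣ p ∣
∣x∷p∣ true  p = refl
∣x∷p∣ false p = refl

lookup-⁅j⁆ : ∀ {n} {i j : Fin n} → i ≢ j → lookup ⁅ j ⁆ i ≡ false
lookup-⁅j⁆ {i = i} {j} i≢j = ¬-not (λ eq → x≢y⇒x∉⁅y⁆ i≢j (lookup⇒[]= i ⁅ j ⁆ eq))

∣⁅i⁆∩p∣ : ∀ {n} (i : Fin n) p → ∣ ⁅ i ⁆ ∩ p ∣ ≡ ⟦ lookup p i ⟧
∣⁅i⁆∩p∣ {suc n} zero (x ∷ p) = begin
  ∣ x ∷ ⊥ {n} ∩ p ∣     ≡⟨ ∣x∷p∣ x (⊥ {n} ∩ p) ⟩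
  ⟦ x ⟧ + ∣ ⊥ {n} ∩ p ∣ ≡⟨ cong (λ r → ⟦ x ⟧ + ∣ r ∣) (∩-zeroˡ p) ⟩
  ⟦ x ⟧ + ∣ ⊥ {n} ∣     ≡⟨ cong (⟦ x ⟧ +_) (∣⊥∣≡0 n) ⟩
  ⟦ x ⟧ + 0             ≡⟨ +-identityʳ ⟦ x ⟧ ⟩
  ⟦ x ⟧                 ∎
  where open ≡-Reasoning
∣⁅i⁆∩p∣ (suc i) (x ∷ p) = ∣⁅i⁆∩p∣ i p

∣[⁅i⁆∪p]∩q∣ : ∀ {n} (i : Fin n) p q → lookup p i ≡ false → ∣ (⁅ i ⁆ ∪ p) ∩ q ∣ ≡ ⟦ lookup q i ⟧ + ∣ p ∩ q ∣
∣[⁅i⁆∪p]∩q∣ {suc n} zero (false ∷ p) (x ∷ q) refl =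
  trans (∣x∷p∣ x ((⊥ {n} ∪ p) ∩ q)) (cong (λ r → ⟦ x ⟧ + ∣ r ∩ q ∣) (∪-identityˡ p))
∣[⁅i⁆∪p]∩q∣ (suc i) (y ∷ p)     (x ∷ q) i∉p  = begin
  ∣ (y ∧ x) ∷ (⁅ i ⁆ ∪ p) ∩ q ∣                ≡⟨ ∣x∷p∣ (y ∧ x) ((⁅ i ⁆ ∪ p) ∩ q) ⟩
  ⟦ y ∧ x ⟧ + ∣ (⁅ i ⁆ ∪ p) ∩ q ∣             ≡⟨ cong (⟦ y ∧ x ⟧ +_) (∣[⁅i⁆∪p]∩q∣ i p q i∉p) ⟩
  ⟦ y ∧ x ⟧ + (⟦ lookup q i ⟧ + ∣ p ∩ q ∣)    ≡⟨ x∙yz≈y∙xz ⟦ y ∧ x ⟧ ⟦ lookup q i ⟧ ∣ p ∩ q ∣ ⟩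
  ⟦ lookup q i ⟧ + (⟦ y ∧ x ⟧ + ∣ p ∩ q ∣)    ≡⟨ cong (⟦ lookup q i ⟧ +_) (∣x∷p∣ (y ∧ x) (p ∩ q)) ⟨
  ⟦ lookup q i ⟧ + ∣ (y ∧ x) ∷ p ∩ q ∣         ∎
  where open ≡-Reasoning

∣⁅i⁆∪p∣ : ∀ {n} (i : Fin n) p → lookup p i ≡ false → ∣ ⁅ i ⁆ ∪ p ∣ ≡ suc ∣ p ∣
∣⁅i⁆∪p∣ i p i∉p = begin
  ∣ ⁅ i ⁆ ∪ p ∣               ≡⟨ cong ∣_∣ (∩-identityʳ (⁅ i ⁆ ∪ p)) ⟨
  ∣ (⁅ i ⁆ ∪ p) ∩ ⊤ ∣         ≡⟨ ∣[⁅i⁆∪p]∩q∣ i p ⊤ i∉p ⟩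
  ⟦ lookup ⊤ i ⟧ + ∣ p ∩ ⊤ ∣ ≡⟨ cong₂ (λ x r → ⟦ x ⟧ + ∣ r ∣) (lookup-replicate i true) (∩-identityʳ p) ⟩
  suc ∣ p ∣                   ∎
  where open ≡-Reasoning

∣⁅i⁆∪⁅j⁆∣ : ∀ {n} {i j : Fin n} → i ≢ j → ∣ ⁅ i ⁆ ∪ ⁅ j ⁆ ∣ ≡ 2
∣⁅i⁆∪⁅j⁆∣ {j = j} i≢j = trans (∣⁅i⁆∪p∣ _ ⁅ j ⁆ (lookup-⁅j⁆ i≢j)) (cong suc (∣⁅x⁆∣≡1 j))

module _ {n} {a b c : Fin n} (a≢b : a ≢ b) (a≢c : a ≢ c) (b≢c : b ≢ c) where

  private
    a∉⁅b⁆∪⁅c⁆ : lookup (⁅ b ⁆ ∪ ⁅ c ⁆) a ≡ false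
    a∉⁅b⁆∪⁅c⁆ = trans (lookup-zipWith _∨_ a ⁅ b ⁆ ⁅ c ⁆) (cong₂ _∨_ (lookup-⁅j⁆ a≢b) (lookup-⁅j⁆ a≢c))

  ∣triple∣ : ∣ triple a b c ∣ ≡ 3
  ∣triple∣ = trans (∣⁅i⁆∪p∣ a (⁅ b ⁆ ∪ ⁅ c ⁆) a∉⁅b⁆∪⁅c⁆) (cong suc (∣⁅i⁆∪⁅j⁆∣ b≢c))

  ∣triple∩p∣ : ∀ p → ∣ triple a b c ∩ p ∣ ≡ ⟦ lookup p a ⟧ + ⟦ lookup p b ⟧ + ⟦ lookup p c ⟧
  ∣triple∩p∣ p = begin
    ∣ triple a b c ∩ p ∣                                  ≡⟨ ∣[⁅i⁆∪p]∩q∣ a _ p a∉⁅b⁆∪⁅c⁆ ⟩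
    ⟦ lookup p a ⟧ + ∣ (⁅ b ⁆ ∪ ⁅ c ⁆) ∩ p ∣              ≡⟨ cong (⟦ lookup p a ⟧ +_) (∣[⁅i⁆∪p]∩q∣ b ⁅ c ⁆ p (lookup-⁅j⁆ b≢c)) ⟩
    ⟦ lookup p a ⟧ + (⟦ lookup p b ⟧ + ∣ ⁅ c ⁆ ∩ p ∣)     ≡⟨ cong (λ k → ⟦ lookup p a ⟧ + (⟦ lookup p b ⟧ + k)) (∣⁅i⁆∩p∣ c p) ⟩
    ⟦ lookup p a ⟧ + (⟦ lookup p b ⟧ + ⟦ lookup p c ⟧)  ≡⟨ +-assoc ⟦ lookup p a ⟧ _ _ ⟨
    ⟦ lookup p a ⟧ + ⟦ lookup p b ⟧ + ⟦ lookup p c ⟧    ∎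
    where open ≡-Reasoning

a∈triple : ∀ {n} (a b c : Fin n) → lookup (triple a b c) a ≡ true
a∈triple a b c = []=⇒lookup (x∈p∪q⁺ (inj₁ (x∈⁅x⁆ a)))

b∈triple : ∀ {n} (a b c : Fin n) → lookup (triple a b c) b ≡ true
b∈triple a b c = []=⇒lookup (x∈p∪q⁺ {p = ⁅ a ⁆} (inj₂ (x∈p∪q⁺ (inj₁ (x∈⁅x⁆ b)))))

c∈triple : ∀ {n} (a b c : Fin n) → lookup (triple a b c) c ≡ true
c∈triple a b c = []=⇒lookup (x∈p∪q⁺ {p = ⁅ a ⁆} (inj₂ (x∈p∪q⁺ {p = ⁅ b ⁆} (inj₂ (x∈⁅x⁆ c)))))

two-of-three≤pairs : ∀ p q r x →
  ⟦ ⌊ ⟦ p ⟧ + ⟦ q ⟧ + ⟦ r ⟧ ≟ 2 ⌋ ∧ x ⟧ ≤ ⟦ p ∧ q ∧ x ⟧ + ⟦ p ∧ r ∧ x ⟧ + ⟦ q ∧ r ∧ x ⟧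
two-of-three≤pairs true  true  true  true  = z≤n
two-of-three≤pairs true  true  false true  = s≤s z≤n
two-of-three≤pairs true  false true  true  = s≤s z≤n
two-of-three≤pairs false true  true  true  = s≤s z≤n
two-of-three≤pairs true  false false true  = z≤n
two-of-three≤pairs false true  false true  = z≤n
two-of-three≤pairs false false true  true  = z≤n
two-of-three≤pairs false false false true  = z≤n
two-of-three≤pairs true  true  true  false = z≤n
two-of-three≤pairs true  true  false false = z≤n
two-of-three≤pairs true  false true  false = z≤n
two-of-three≤pairs false true  true  false = z≤n
two-of-three≤pairs true  false false false = z≤n
two-of-three≤pairs false true  false false = z≤n
two-of-three≤pairs false false true  false = z≤n
two-of-three≤pairs false false false false = z≤n

module _ {n} (X : Subset n → Bool) {a b c : Fin n} (a≢b : a ≢ b) (a≢c : a ≢ c) (b≢c : b ≢ c) where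

  private
    T : Subset n
    T = triple a b c

    inX₁ : Fin n → Fin n → Subset n → Bool
    inX₁ i j t = lookup t i ∧ lookup t j ∧ X t

    bound : Subset n → ℕ
    bound t = ⟦ inX₁ a b t ⟧ + ⟦ inX₁ a c t ⟧ + ⟦ inX₁ b c t ⟧

    T∈vertices : T ∈ vertices n
    T∈vertices = ∈-filter⁺ (T? ∘ λ s → ⌊ ∣ s ∣ ≟ 3 ⌋) (∈-allSubsets T) (fromWitness (∣triple∣ a≢b a≢c b≢c))

    sum-bound : ∀ xs → sum (map bound xs) ≡ count (inX₁ a b) xs + count (inX₁ a c) xs + count (inX₁ b c) xs
    sum-bound xs = begin
      sum (map bound xs)
        ≡⟨ sum-map-+ (λ t → ⟦ inX₁ a b t ⟧ + ⟦ inX₁ a c t ⟧) (⟦_⟧ ∘ inX₁ b c) xs ⟩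
      sum (map (λ t → ⟦ inX₁ a b t ⟧ + ⟦ inX₁ a c t ⟧) xs) + Σ b c
        ≡⟨ cong (_+ Σ b c) (sum-map-+ (⟦_⟧ ∘ inX₁ a b) (⟦_⟧ ∘ inX₁ a c) xs) ⟩
      Σ a b + Σ a c + Σ b c
        ≡⟨ cong₂ _+_ (cong₂ _+_ (count≡sum (inX₁ a b) xs) (count≡sum (inX₁ a c) xs)) (count≡sum (inX₁ b c) xs) ⟨
      count (inX₁ a b) xs + count (inX₁ a c) xs + count (inX₁ b c) xs
        ∎
      where
      open ≡-Reasoning
      Σ : Fin n → Fin n → ℕ
      Σ i j = sum (map (⟦_⟧ ∘ inX₁ i j) xs)

  X₁-neighbours+3≤pairCounts : X T ≡ true →
    nbrsIn X true T + 3 ≤ pairCount X a b + pairCount X a c + pairCount X b c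
  X₁-neighbours+3≤pairCounts X₁∋T = begin
    nbrsIn X true T + 3                                 ≡⟨ cong (_+ 3) (count≡sum adjacentInX₁ (vertices n)) ⟩
    sum (map (⟦_⟧ ∘ adjacentInX₁) (vertices n)) + 3     ≤⟨ sum-map-mono-∈ 3 pointwise T∈vertices atT ⟩
    sum (map bound (vertices n))                        ≡⟨ sum-bound (vertices n) ⟩
    pairCount X a b + pairCount X a c + pairCount X b c ∎
    where
    open ≤-Reasoning
    adjacentInX₁ : Subset n → Bool
    adjacentInX₁ t = adjᵇ T t ∧ X t
    pointwise : ∀ t → ⟦ adjacentInX₁ t ⟧ ≤ bound t
    pointwise t rewrite ∣triple∩p∣ a≢b a≢c b≢c t = two-of-three≤pairs (lookup t a) (lookup t b) (lookup t c) (X t)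
    atT : ⟦ adjacentInX₁ T ⟧ + 3 ≤ bound T
    atT rewrite ∩-idem T | ∣triple∣ a≢b a≢c b≢c | X₁∋T | a∈triple a b c | b∈triple a b c | c∈triple a b c = ≤-refl

-- does, unlike the ⌊_⌋ of Defs, reduces through the map′ inside _≟_ and _⊆?_; count-supersets relies on this.
supersets : ∀ {n} → Subset n → ℕ → Subset n → Bool
supersets p m s = does (∣ s ∣ ≟ m) ∧ does (p ⊆? s)

count-supersets : ∀ {n} (p : Subset n) k → count (supersets p (∣ p ∣ + k)) (allSubsets n) ≡ (n ∸ ∣ p ∣) C k
count-supersets [] zero    = refl
count-supersets [] (suc k) = refl
count-supersets {suc n} (true ∷ p) k = begin
  count (supersets (true ∷ p) (suc ∣ p ∣ + k)) (allSubsets (suc n))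
    ≡⟨ count-allSubsets (supersets (true ∷ p) (suc ∣ p ∣ + k)) ⟩
  count (supersets p (∣ p ∣ + k)) (allSubsets n) + count (supersets (true ∷ p) (suc ∣ p ∣ + k) ∘ (false ∷_)) (allSubsets n)
    ≡⟨ cong₂ _+_ (count-supersets p k) (count-none head-missing (allSubsets n)) ⟩
  (n ∸ ∣ p ∣) C k + 0
    ≡⟨ +-identityʳ _ ⟩
  (n ∸ ∣ p ∣) C k ∎
  where
  open ≡-Reasoning
  head-missing : ∀ s → supersets (true ∷ p) (suc ∣ p ∣ + k) (false ∷ s) ≡ false
  head-missing s = ∧-zeroʳ (does (∣ s ∣ ≟ suc ∣ p ∣ + k))
count-supersets {suc n} (false ∷ p) zero = begin
  count (supersets (false ∷ p) (∣ p ∣ + 0)) (allSubsets (suc n))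
    ≡⟨ count-allSubsets (supersets (false ∷ p) (∣ p ∣ + 0)) ⟩
  count (supersets (false ∷ p) (∣ p ∣ + 0) ∘ (true ∷_)) (allSubsets n) + count (supersets p (∣ p ∣ + 0)) (allSubsets n)
    ≡⟨ cong₂ _+_ (count-none too-small (allSubsets n)) (count-supersets p 0) ⟩
  1 ∎
  where
  open ≡-Reasoning
  too-small : ∀ s → supersets (false ∷ p) (∣ p ∣ + 0) (true ∷ s) ≡ false
  too-small s with p ⊆? s
  ... | no  _   = ∧-zeroʳ _
  ... | yes p⊆s = cong (_∧ true) (dec-false (suc ∣ s ∣ ≟ ∣ p ∣ + 0) λ eq →
    1+n≰n (≤-trans (≤-reflexive (trans eq (+-identityʳ ∣ p ∣))) (p⊆q⇒∣p∣≤∣q∣ p⊆s)))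
count-supersets {suc n} (false ∷ p) (suc k) = begin
  count (supersets (false ∷ p) (∣ p ∣ + suc k)) (allSubsets (suc n))
    ≡⟨ count-allSubsets (supersets (false ∷ p) (∣ p ∣ + suc k)) ⟩
  count (supersets (false ∷ p) (∣ p ∣ + suc k) ∘ (true ∷_)) (allSubsets n) + count (supersets p (∣ p ∣ + suc k)) (allSubsets n)
    ≡⟨ cong₂ _+_ (trans (count-cong shift (allSubsets n)) (count-supersets p k)) (count-supersets p (suc k)) ⟩
  (n ∸ ∣ p ∣) C k + (n ∸ ∣ p ∣) C suc k
    ≡⟨ nCk+nC[k+1]≡[n+1]C[k+1] (n ∸ ∣ p ∣) k ⟩
  suc (n ∸ ∣ p ∣) C suc k
    ≡⟨ cong (_C suc k) (+-∸-assoc 1 (∣p∣≤n p)) ⟨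
  (suc n ∸ ∣ p ∣) C suc k ∎
  where
  open ≡-Reasoning
  shift : ∀ s → supersets (false ∷ p) (∣ p ∣ + suc k) (true ∷ s) ≡ supersets p (∣ p ∣ + k) s
  shift s = cong (λ m → does (suc ∣ s ∣ ≟ m) ∧ does (p ⊆? s)) (+-suc ∣ p ∣ k)

⁅i⁆∪⁅j⁆⊆p : ∀ {n} {i j : Fin n} {p} → lookup p i ≡ true → lookup p j ≡ true → ⁅ i ⁆ ∪ ⁅ j ⁆ ⊆ p
⁅i⁆∪⁅j⁆⊆p {i = i} {j} {p} i∈p j∈p x∈⁅i⁆∪⁅j⁆ with x∈p∪q⁻ ⁅ i ⁆ ⁅ j ⁆ x∈⁅i⁆∪⁅j⁆
... | inj₁ x∈⁅i⁆ rewrite x∈⁅y⁆⇒x≡y i x∈⁅i⁆ = lookup⇒[]= i p i∈p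
... | inj₂ x∈⁅j⁆ rewrite x∈⁅y⁆⇒x≡y j x∈⁅j⁆ = lookup⇒[]= j p j∈p

pairCount≤n∸2 : ∀ {n} (X : Subset n → Bool) {a b : Fin n} → a ≢ b → pairCount X a b ≤ n ∸ 2
pairCount≤n∸2 {n} X {a} {b} a≢b = begin
  pairCount X a b                                      ≡⟨ count-filterᵇ isVertex inX₁ (allSubsets n) ⟩
  count (λ t → isVertex t ∧ inX₁ t) (allSubsets n)     ≤⟨ count-mono vertex⇒superset (allSubsets n) ⟩
  count (supersets pair 3) (allSubsets n)              ≡⟨ cong (λ m → count (supersets pair (m + 1)) (allSubsets n)) ∣pair∣ ⟨
  count (supersets pair (∣ pair ∣ + 1)) (allSubsets n) ≡⟨ count-supersets pair 1 ⟩
  (n ∸ ∣ pair ∣) C 1                                   ≡⟨ nC1≡n _ ⟩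
  n ∸ ∣ pair ∣                                         ≡⟨ cong (n ∸_) ∣pair∣ ⟩
  n ∸ 2                                                ∎
  where
  open ≤-Reasoning
  pair : Subset n
  pair = ⁅ a ⁆ ∪ ⁅ b ⁆
  ∣pair∣ : ∣ pair ∣ ≡ 2
  ∣pair∣ = ∣⁅i⁆∪⁅j⁆∣ a≢b
  isVertex inX₁ : Subset n → Bool
  isVertex t = ⌊ ∣ t ∣ ≟ 3 ⌋
  inX₁ t = lookup t a ∧ lookup t b ∧ X t
  vertex⇒superset : ∀ t → isVertex t ∧ inX₁ t ≡ true → supersets pair 3 t ≡ true
  vertex⇒superset t h with ∣ t ∣ ≟ 3 | lookup t a in a∈t | lookup t b in b∈t
  ... | yes ∣t∣≡3 | true | true = cong₂ _∧_ (dec-true (∣ t ∣ ≟ 3) ∣t∣≡3) (dec-true (pair ⊆? t) (⁅i⁆∪⁅j⁆⊆p a∈t b∈t))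

gap≤2 : ∀ p BC d → p + 3 ≤ (d + (d + BC)) + (d + BC) + BC → d + (d + BC) ≤ 2 + 2 * d →
        2 * (4 + 2 * d) ≤ p + 7 → d ≤ 2
gap≤2 p BC d neighbours pair-bound p₁₁-bound = +-cancelʳ-≤ 11 d 2 (+-cancelˡ-≤ (3 * d) (d + 11) 13 (begin
  3 * d + (d + 11)                   ≡⟨ lhs-shape d ⟩
  2 * (4 + 2 * d) + 3                ≤⟨ +-monoˡ-≤ 3 p₁₁-bound ⟩
  p + 7 + 3                          ≡⟨ xy∙z≈xz∙y p 7 3 ⟩
  p + 3 + 7                          ≤⟨ +-monoˡ-≤ 7 neighbours ⟩
  (d + (d + BC)) + (d + BC) + BC + 7 ≡⟨ rhs-shape d BC ⟩
  3 * d + (3 * BC + 7)               ≤⟨ +-monoʳ-≤ (3 * d) (+-monoˡ-≤ 7 (*-monoʳ-≤ 3 BC≤2)) ⟩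
  3 * d + 13                         ∎))
  where
  open ≤-Reasoning
  lhs-shape : ∀ d → 3 * d + (d + 11) ≡ 2 * (4 + 2 * d) + 3
  lhs-shape = solve-∀
  rhs-shape : ∀ d BC → (d + (d + BC)) + (d + BC) + BC + 7 ≡ 3 * d + (3 * BC + 7)
  rhs-shape = solve-∀
  pair-shape : ∀ d BC → d + (d + BC) ≡ 2 * d + BC
  pair-shape = solve-∀
  BC≤2 : BC ≤ 2
  BC≤2 = +-cancelˡ-≤ (2 * d) BC 2 (begin
    2 * d + BC   ≡⟨ pair-shape d BC ⟨
    d + (d + BC) ≤⟨ pair-bound ⟩
    2 + 2 * d    ≡⟨ +-comm 2 (2 * d) ⟩
    2 * d + 2    ∎)

counting-bounds⇒n≤8 : ∀ {n p AB AC BC} → 6 ≤ n → BC ≤ AC → AC ≤ AB →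
  2 * (AB ∸ AC) ≡ n ∸ 4 → 2 * (AC ∸ BC) ≡ n ∸ 4 →
  p + 3 ≤ AB + AC + BC → AB ≤ n ∸ 2 → 2 * n ≤ p + 7 → n ≤ 8
counting-bounds⇒n≤8 {n} {p} {AB} {AC} {BC} 6≤n BC≤AC AC≤AB 2d≡n-4 2d′≡n-4 neighbours pair-bound p₁₁-bound = begin
  n         ≡⟨ n≡4+2d ⟩
  4 + 2 * d ≤⟨ +-monoʳ-≤ 4 (*-monoʳ-≤ 2 (gap≤2 p BC d neighbours′ pair-bound′ p₁₁-bound′)) ⟩
  8         ∎
  where
  open ≤-Reasoning
  d : ℕ
  d = AB ∸ AC
  AC≡d+BC : AC ≡ d + BC
  AC≡d+BC = trans (sym (m∸n+n≡m BC≤AC)) (cong (_+ BC) (*-cancelˡ-≡ (AC ∸ BC) d 2 (trans 2d′≡n-4 (sym 2d≡n-4))))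
  AB≡d+AC : AB ≡ d + AC
  AB≡d+AC = sym (m∸n+n≡m AC≤AB)
  n≡4+2d : n ≡ 4 + 2 * d
  n≡4+2d = trans (sym (m+[n∸m]≡n (≤-trans (m≤m+n 4 2) 6≤n))) (cong (4 +_) (sym 2d≡n-4))
  AB≡ : AB ≡ d + (d + BC)
  AB≡ = trans AB≡d+AC (cong (d +_) AC≡d+BC)
  neighbours′ : p + 3 ≤ (d + (d + BC)) + (d + BC) + BC
  neighbours′ = subst (λ m → p + 3 ≤ m) (cong₂ _+_ (cong₂ _+_ AB≡ AC≡d+BC) refl) neighbours
  pair-bound′ : d + (d + BC) ≤ 2 + 2 * d
  pair-bound′ = subst₂ _≤_ AB≡ (cong (_∸ 2) n≡4+2d) pair-bound
  p₁₁-bound′ : 2 * (4 + 2 * d) ≤ p + 7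
  p₁₁-bound′ = subst (λ m → 2 * m ≤ p + 7) n≡4+2d p₁₁-bound

mainTheorem10 : (n : ℕ) → 6 ≤ n → (X : Subset n → Bool) → (q : Quot) →
    IsEquitable n X q → Isλ₂ n q →
    Quot.p22 q ≤ Quot.p11 q → 2 * n ≤ Quot.p11 q + 7 →
    (a b c : Fin n) → a ≢ b → a ≢ c → b ≢ c → X (triple a b c) ≡ true →
    pairCount X a c ≤ pairCount X a b → pairCount X b c ≤ pairCount X a c →
    2 * (pairCount X a b ∸ pairCount X a c) ≡ n ∸ 4 →
    2 * (pairCount X a c ∸ pairCount X b c) ≡ n ∸ 4 →
    n ≤ 8
mainTheorem10 n 6≤n X q equitable _ _ p₁₁-bound a b c a≢b a≢c b≢c abc∈X₁ AC≤AB BC≤AC 2d≡n-4 2d′≡n-4 =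
  counting-bounds⇒n≤8 6≤n BC≤AC AC≤AB 2d≡n-4 2d′≡n-4 neighbours (pairCount≤n∸2 X a≢b) p₁₁-bound
  where
  nbrsIn≡p₁₁ : nbrsIn X true (triple a b c) ≡ Quot.p11 q
  nbrsIn≡p₁₁ = trans (IsEquitable.regular equitable (triple a b c) (∣triple∣ a≢b a≢c b≢c) true)
                     (cong (λ x → entry q x true) abc∈X₁)
  neighbours : Quot.p11 q + 3 ≤ pairCount X a b + pairCount X a c + pairCount X b c
  neighbours = subst (λ m → m + 3 ≤ _) nbrsIn≡p₁₁ (X₁-neighbours+3≤pairCounts X a≢b a≢c b≢c abc∈X₁)
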